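{- Let $(I,\leq)$ be a partially ordered set in which every two elements $\alpha,\beta$ have a least upper bound $\alpha\vee\beta$. Let $(S_\alpha)_{\alpha\in I}$ be a family of pairwise disjoint semigroups (the product in $S_\alpha$ being denoted $\cdot_\alpha$), and for all $\beta\leq\alpha$ in $I$ let $\phi_{\alpha\beta}:S_\beta\to S_\alpha$ be a semigroup morphism, such that $\phi_{\alpha\alpha}=\mathrm{Id}_{S_\alpha}$ for all $\alpha\in I$ and $\phi_{\alpha\beta}\circ\phi_{\beta\gamma}=\phi_{\alpha\gamma}$ for all $\gamma\leq\beta\leq\alpha$. Let $S=\bigsqcup_{\alpha\in I}S_\alpha$, for $x\in S$ let $\lambda(x)$ be the unique $\alpha\in I$ with $x\in S_\alpha$, and endow $S$ with the semigroup law $$x\star y=\phi_{(\lambda(x)\vee\lambda(y))\,\lambda(x)}(x)\cdot_{\lambda(x)\vee\lambda(y)}\phi_{(\lambda(x)\vee\lambda(y))\,\lambda(y)}(y).$$ Then $(S,\star)$ is a finite decomposition semigroup if and only if the following three conditions hold: (i) for every $\alpha\in I$ and every $y\in S_\alpha$, the set $\{\beta\in I:\ \beta\leq\alpha,\ \phi_{\alpha\beta}^{ -1}(y)\neq\emptyset\}$ is finite; (ii) every $S_\alpha$ is a finite decomposition semigroup; (iii) for all $\beta\leq\alpha$ in $I$ and every $x\in S_\alpha$, the fiber $\phi_{\alpha\beta}^{ -1}(x)\subseteq S_\beta$ is finite.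
   Context: A semigroup $T$ is called a finite decomposition semigroup (or has the finite decomposition property) if for every $t\in T$ the set of pairs $(t_1,t_2)\in T\times T$ with $t_1t_2=t$ is finite. The semigroup $(S,\star)$ defined in the claim is called the disjoint direct limit of the family $(S_\alpha)$. -}

module Defs where

open import Level using (Level; _⊔_; suc)
open import Data.Product using (Σ; Σ-syntax; ∃; _×_; _,_; proj₁; proj₂)
open import Data.List using (List)
open import Data.List.Membership.Propositional using (_∈_)
open import Relation.Nullary using (¬_)
open import Relation.Binary.PropositionalEquality using (_≡_)
open import Relation.Binary.Structures using (IsPartialOrder)
open import Relation.Binary.Lattice.Definitions using (Supremum)
open import Algebra.Structures using (IsSemigroup)

-- A subset (predicate) P of a type A is finite: (classically) there is a
-- finite list containing every element satisfying P.  The double negation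
-- makes the notion classically exact while keeping it provable in the
-- classical style of the paper.
Finite : ∀ {a p} {A : Set a} → (A → Set p) → Set (a ⊔ p)
Finite {A = A} P = ¬ ¬ (Σ[ xs ∈ List A ] (∀ x → P x → x ∈ xs))

FinDecomp : ∀ {a} (A : Set a) → (A → A → A) → Set a
FinDecomp A _∙_ = ∀ (t : A) → Finite (λ (p : A × A) → (proj₁ p ∙ proj₂ p) ≡ t)

-- The data of the claim: a join-semilattice-ordered poset (I, ≤) with
-- binary least upper bounds, a family of semigroups S α (the disjointness is
-- realised by taking the disjoint union Σ I S), and transition morphisms
-- φ α β : S β → S α for β ≤ α, compatible with identities and composition.
record DirectSystem (i r s : Level) : Set (suc (i ⊔ r ⊔ s)) where
  field
    I            : Set i
    _≤_          : I → I → Set r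
    isPartialOrder : IsPartialOrder _≡_ _≤_
    _∨_          : I → I → I
    ∨-supremum   : Supremum _≤_ _∨_
    S            : I → Set s
    mul          : ∀ α → S α → S α → S α
    isSemigroup  : ∀ α → IsSemigroup _≡_ (mul α)
    φ            : ∀ α β → .(β ≤ α) → S β → S α
    φ-hom        : ∀ α β .(p : β ≤ α) (x y : S β) →
                   φ α β p (mul β x y) ≡ mul α (φ α β p x) (φ α β p y)
    φ-id         : ∀ α .(p : α ≤ α) (x : S α) → φ α α p x ≡ x
    φ-comp       : ∀ α β γ .(p : β ≤ α) .(q : γ ≤ β) .(r : γ ≤ α) (x : S γ) →
                   φ α β p (φ β γ q x) ≡ φ α γ r x

  Carrier : Set (i ⊔ s)
  Carrier = Σ I S

  lam : Carrier → I
  lam = proj₁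

  _⋆_ : Carrier → Carrier → Carrier
  (α , x) ⋆ (β , y) =
    (α ∨ β) , mul (α ∨ β) (φ (α ∨ β) α (proj₁ (∨-supremum α β)) x)
                          (φ (α ∨ β) β (proj₁ (proj₂ (∨-supremum α β))) y)

  Cond-i : Set (i ⊔ r ⊔ s)
  Cond-i = ∀ α (y : S α) →
    Finite (λ (β : I) → Σ[ p ∈ β ≤ α ] Σ[ x ∈ S β ] φ α β p x ≡ y)

  Cond-ii : Set (i ⊔ s)
  Cond-ii = ∀ α → FinDecomp (S α) (mul α)

  Cond-iii : Set (i ⊔ r ⊔ s)
  Cond-iii = ∀ α β (p : β ≤ α) (x : S α) →
    Finite (λ (z : S β) → φ α β p z ≡ x)

module Submission where

-- Write ↓u for the lower preimage ⋃_{α ≤ γ} φ_γα⁻¹(u) of u ∈ S_γ.  A decomposition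
-- c ⋆ d = w in S_γ has c ∈ ↓u and d ∈ ↓v for a decomposition u · v = w in S_γ,
-- so there are finitely many: (ii) bounds the pairs (u, v), and (i) with (iii)
-- makes each ↓u finite.  Conversely, if z ↦ x under φ_αβ then (β, z) ⋆ (α, x) = x · x,
-- so the decompositions of x · x in the limit bound both the levels and the fibres
-- over x, while the decompositions inside S_α embed into those of the limit.

open import Defs
open import Level using (Level; _⊔_)
open import Data.Product using (_×_; Σ; Σ-syntax; ∃; _,_; proj₁; proj₂)
open import Data.List using (List; []; _∷_; _++_)
open import Data.List.Membership.Propositional using (_∈_)
open import Data.List.Membership.Propositional.Properties using (∈-++⁺ˡ; ∈-++⁺ʳ)
open import Data.List.Relation.Unary.Any using (here; there)
open import Function.Base using (_∘_)
open import Function.Bundles using (_⇔_; mk⇔)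
open import Function.Definitions using (Injective)
open import Relation.Binary.PropositionalEquality using (_≡_; refl; sym; trans; cong)
open import Relation.Binary.Lattice.Bundles using (JoinSemilattice)
import Relation.Binary.Lattice.Properties.JoinSemilattice as JoinSemilatticeProperties
open import Relation.Nullary using (¬_; yes; no)
open import Relation.Nullary.Decidable using (¬¬-excluded-middle)
open import Relation.Nullary.Negation using (contradiction)
open import Relation.Unary using (_⊆_)

-- Finite is a double negation, so its proofs run in the ¬¬ monad, where
-- excluded middle is available.
private
  variable
    a b p q : Level
    A : Set a
    B : Set b

  pure : A → ¬ ¬ A
  pure x k = k x

  _>>=_ : ¬ ¬ A → (A → ¬ ¬ B) → ¬ ¬ B
  (m >>= f) k = m λ x → f x k

Covers : {A : Set a} → (A → Set p) → List A → Set (a ⊔ p)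
Covers P xs = ∀ x → P x → x ∈ xs

finite-⊆ : {P : A → Set p} {Q : A → Set q} → Q ⊆ P → Finite P → Finite Q
finite-⊆ Q⊆P fP = do
  (xs , cover) ← fP
  pure (xs , λ x qx → cover x (Q⊆P qx))

finite-subsingleton : {P : A → Set p} → (∀ {x y} → P x → P y → x ≡ y) → Finite P
finite-subsingleton {P = P} unique = do
  yes (x , px) ← ¬¬-excluded-middle {A = ∃ P}
    where no ∄P → pure ([] , λ y py → contradiction (y , py) ∄P)
  pure (x ∷ [] , λ y py → here (unique py px))

finite-⋃ : {P : A → Set p} {Q : A → B → Set q} →
           Finite P → (∀ x → P x → Finite (Q x)) →
           Finite (λ y → Σ[ x ∈ A ] (P x × Q x y))
finite-⋃ {A = A} {B = B} {P = P} {Q = Q} fP fQ = do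
  (xs , cover) ← fP
  (ys , coverQ) ← coverAll xs
  pure (ys , λ { y (x , px , qxy) → coverQ x (cover x px) px y qxy })
  where
  coverIfP : ∀ x → ¬ ¬ (Σ[ ys ∈ List B ] (P x → Covers (Q x) ys))
  coverIfP x = do
    yes px ← ¬¬-excluded-middle {A = P x}
      where no ¬px → pure ([] , λ px → contradiction px ¬px)
    (ys , cover) ← fQ x px
    pure (ys , λ _ → cover)

  coverAll : (xs : List A) →
             ¬ ¬ (Σ[ ys ∈ List B ] (∀ x → x ∈ xs → P x → Covers (Q x) ys))
  coverAll [] = pure ([] , λ _ ())
  coverAll (x ∷ xs) = do
    (ys , coverXs) ← coverAll xs
    (zs , coverX) ← coverIfP x
    pure (zs ++ ys , λ
      { _ (here refl) px y q → ∈-++⁺ˡ (coverX px y q)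
      ; x′ (there x′∈xs) px y q → ∈-++⁺ʳ zs (coverXs x′ x′∈xs px y q) })

finite-image : {P : A → Set p} (f : A → B) →
               Finite P → Finite (λ y → Σ[ x ∈ A ] (P x × f x ≡ y))
finite-image f fP = finite-⋃ fP λ _ _ → finite-subsingleton λ e e′ → trans (sym e) e′

finite-preimage : {P : B → Set p} (g : A → B) →
                  Injective _≡_ _≡_ g → Finite P → Finite (P ∘ g)
finite-preimage g g-injective fP =
  finite-⊆ (λ {x} px → g x , px , refl)
    (finite-⋃ {Q = λ y x → g x ≡ y} fP λ _ _ → finite-subsingleton λ e e′ → g-injective (trans e (sym e′)))

finite-Σ : {B : A → Set b} {P : A → Set p} {Q : (x : A) → B x → Set q} →
           Finite P → (∀ x → P x → Finite (Q x)) →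
           Finite (λ (c : Σ A B) → P (proj₁ c) × Q (proj₁ c) (proj₂ c))
finite-Σ fP fQ =
  finite-⊆ (λ { {x , y} (px , qxy) → x , px , (y , qxy , refl) })
    (finite-⋃ fP λ x px → finite-image (x ,_) (fQ x px))

module DirectLimit {i r s : Level} (D : DirectSystem i r s) where
  open DirectSystem D

  joinSemilattice : JoinSemilattice i i r
  joinSemilattice = record
    { isJoinSemilattice = record { isPartialOrder = isPartialOrder ; supremum = ∨-supremum } }

  open JoinSemilattice joinSemilattice using (x≤x∨y; y≤x∨y) renaming (refl to ≤-refl)
  open JoinSemilatticeProperties joinSemilattice using (x≤y⇒x∨y≈y)

  ⋆-below : ∀ {β α} (p : β ≤ α) (z : S β) (x : S α) →
            (β , z) ⋆ (α , x) ≡ (α , mul α (φ α β p z) x)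
  ⋆-below {β} {α} p z x = absorb (β ∨ α) (x≤y⇒x∨y≈y p) (x≤x∨y β α) (y≤x∨y β α)
    where
    absorb : ∀ γ → γ ≡ α → .(q : β ≤ γ) .(q′ : α ≤ γ) →
             (γ , mul γ (φ γ β q z) (φ γ α q′ x)) ≡ (α , mul α (φ α β p z) x)
    absorb γ refl q q′ = cong (λ x′ → γ , mul γ (φ γ β q z) x′) (φ-id γ q′ x)

  ⋆-diagonal : ∀ α (x y : S α) → (α , x) ⋆ (α , y) ≡ (α , mul α x y)
  ⋆-diagonal α x y = trans (⋆-below ≤-refl x y) (cong (λ x′ → α , mul α x′ y) (φ-id α ≤-refl x))

  ⋆-fibre : ∀ {β α} (p : β ≤ α) {z : S β} {x : S α} →
            φ α β p z ≡ x → (β , z) ⋆ (α , x) ≡ (α , mul α x x)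
  ⋆-fibre {α = α} p {z} {x} φz≡x = trans (⋆-below p z x) (cong (λ u → α , mul α u x) φz≡x)

  FinDecomp⇒Cond-i : FinDecomp Carrier _⋆_ → Cond-i
  FinDecomp⇒Cond-i fd α y =
    finite-⊆ (λ { {β} (p , z , φz≡y) → ((β , z) , (α , y)) , ⋆-fibre p φz≡y , refl })
      (finite-image (lam ∘ proj₁) (fd (α , mul α y y)))

  FinDecomp⇒Cond-ii : FinDecomp Carrier _⋆_ → Cond-ii
  FinDecomp⇒Cond-ii fd α t =
    finite-⊆ (λ { {x , y} xy≡t → trans (⋆-diagonal α x y) (cong (α ,_) xy≡t) })
      (finite-preimage (λ (x , y) → (α , x) , (α , y)) (λ { refl → refl }) (fd (α , t)))

  FinDecomp⇒Cond-iii : FinDecomp Carrier _⋆_ → Cond-iii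
  FinDecomp⇒Cond-iii fd α β p x =
    finite-⊆ (⋆-fibre p)
      (finite-preimage (λ z → (β , z) , (α , x)) (λ { refl → refl }) (fd (α , mul α x x)))

  LowerPreimage : (γ : I) → S γ → Carrier → Set (r ⊔ s)
  LowerPreimage γ u (α , x) = Σ[ p ∈ α ≤ γ ] φ γ α p x ≡ u

  finite-LowerPreimage : Cond-i → Cond-iii → ∀ γ u → Finite (LowerPreimage γ u)
  finite-LowerPreimage ci ciii γ u =
    finite-⊆ (λ { {α , x} (p , φx≡u) → (p , x , φx≡u) , p , φx≡u })
      (finite-Σ (ci γ u) λ { α (p , _) → finite-⊆ (λ (_ , φx≡u) → φx≡u) (ciii γ α p u) })

  OverDecomposition : (γ : I) → S γ → Carrier × Carrier → Set (r ⊔ s)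
  OverDecomposition γ w (c , d) =
    Σ[ uv ∈ S γ × S γ ] (mul γ (proj₁ uv) (proj₂ uv) ≡ w ×
                         LowerPreimage γ (proj₁ uv) c × LowerPreimage γ (proj₂ uv) d)

  ⋆-decomposition-over : ∀ c d {t} → c ⋆ d ≡ t → OverDecomposition (lam t) (proj₂ t) (c , d)
  ⋆-decomposition-over (α , x) (β , y) refl =
    (φ (α ∨ β) α (x≤x∨y α β) x , φ (α ∨ β) β (y≤x∨y α β) y) , refl ,
    (x≤x∨y α β , refl) , (y≤x∨y α β , refl)

  Conds⇒FinDecomp : Cond-i → Cond-ii → Cond-iii → FinDecomp Carrier _⋆_
  Conds⇒FinDecomp ci cii ciii (γ , w) =
    finite-⊆ (λ { {c , d} → ⋆-decomposition-over c d })
      (finite-⋃ (cii γ w) λ (u , v) _ →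
        finite-Σ (finite-LowerPreimage ci ciii γ u) λ _ _ → finite-LowerPreimage ci ciii γ v)

mainTheorem1 : ∀ {i r s : Level} (D : DirectSystem i r s) →
    let open DirectSystem D in
    FinDecomp Carrier _⋆_ ⇔ (Cond-i × Cond-ii × Cond-iii)
mainTheorem1 D = mk⇔
  (λ fd → FinDecomp⇒Cond-i fd , FinDecomp⇒Cond-ii fd , FinDecomp⇒Cond-iii fd)
  (λ (ci , cii , ciii) → Conds⇒FinDecomp ci cii ciii)
  where open DirectLimit D
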